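{- Let $G$ be a finite simple graph, let $\Gamma\subseteq\Omega(G)$ and $\emptyset\neq\Gamma'\subseteq\mathrm{MaxCritIndep}(G)$ be such that for every $A\in\Gamma'$ there exists $S\in\Gamma$ with $A\subseteq S$. If $\bigcup\Gamma'=\bigcup\Gamma$, then $G$ is a König–Egerváry graph.
   Context: For a graph $G$ and $A\subseteq V(G)$: $N(A)=\{v\in V(G): v \text{ has a neighbor in } A\}$. A set is independent if no two of its vertices are adjacent; $\mathrm{Ind}(G)$ is the family of independent sets, $\alpha(G)$ the maximum size of an independent set, and $\Omega(G)$ the family of all maximum independent sets. $\mu(G)$ is the maximum cardinality of a matching; $G$ is a König–Egerváry graph if $\alpha(G)+\mu(G)=|V(G)|$. The difference of $X\subseteq V(G)$ is $d(X)=|X|-|N(X)|$. An independent set $A$ is critical if $d(A)=\max\{d(I):I\in\mathrm{Ind}(G)\}$. A maximum critical independent set is a critical independent set of maximum cardinality among all critical independent sets; $\mathrm{MaxCritIndep}(G)$ denotes the family of all of them. -}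

module Defs where

open import Data.Nat using (ℕ; _≤_; _+_)
open import Data.Integer as ℤ using (ℤ; _-_; +_)
open import Data.Bool using (Bool; true; false; _∧_; _∨_)
open import Data.Fin as Fin using (Fin)
open import Data.Fin.Subset using (Subset; _∈_; _⊆_; ∣_∣)
open import Data.Vec using (tabulate; lookup)
open import Data.List using (List; length; concatMap; _∷_; [])
open import Data.List.Relation.Unary.All using (All)
open import Data.List.Relation.Unary.Unique.Propositional using (Unique)
open import Data.Product using (_×_; Σ; ∃; _,_; proj₁; proj₂)
open import Relation.Binary.PropositionalEquality using (_≡_)
open import Function.Bundles using (_⇔_)

record Graph (n : ℕ) : Set where
  field
    adj   : Fin n → Fin n → Bool
    sym   : ∀ u v → adj u v ≡ adj v u
    irrefl : ∀ v → adj v v ≡ false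
open Graph public

module _ {n : ℕ} (G : Graph n) where

  private
    anyFin : ∀ {m} → (Fin m → Bool) → Bool
    anyFin {ℕ.zero} f = false
    anyFin {ℕ.suc m} f = f Fin.zero ∨ anyFin (λ i → f (Fin.suc i))

  N : Subset n → Subset n
  N A = tabulate (λ v → anyFin (λ u → lookup A u ∧ adj G v u))

  Independent : Subset n → Set
  Independent A = ∀ u v → u ∈ A → v ∈ A → adj G u v ≡ false

  MaximumIndependent : Subset n → Set
  MaximumIndependent S = Independent S × (∀ I → Independent I → ∣ I ∣ ≤ ∣ S ∣)

  d : Subset n → ℤ
  d X = + ∣ X ∣ - + ∣ N X ∣

  Critical : Subset n → Set
  Critical A = Independent A × (∀ I → Independent I → d I ℤ.≤ d A)

  MaxCritical : Subset n → Set
  MaxCritical A = Critical A × (∀ B → Critical B → ∣ B ∣ ≤ ∣ A ∣)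

  endpoints : List (Fin n × Fin n) → List (Fin n)
  endpoints = concatMap (λ e → proj₁ e ∷ proj₂ e ∷ [])

  Matching : List (Fin n × Fin n) → Set
  Matching M = All (λ e → adj G (proj₁ e) (proj₂ e) ≡ true) M × Unique (endpoints M)

  MaximumMatching : List (Fin n × Fin n) → Set
  MaximumMatching M = Matching M × (∀ M' → Matching M' → length M' ≤ length M)

  KonigEgervary : Set
  KonigEgervary = Σ (Subset n) λ S → Σ (List (Fin n × Fin n)) λ M →
    MaximumIndependent S × MaximumMatching M × (∣ S ∣ + length M ≡ n)

_∈⋃_ : ∀ {n} → Fin n → (Subset n → Set) → Set
v ∈⋃ Γ = ∃ λ S → Γ S × v ∈ S

-- Take A ∈ Γ′ and S ∈ Γ with A ⊆ S.
--  * Hall property (Larson): for a critical independent A, every C ⊆ N(A)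
--    has at least |C| neighbours in A (critical-hall).
--  * Covering: a maximum critical independent A contains every critical
--    independent B in A ∪ N(A); otherwise A together with the part of B
--    beyond A ∪ N(A) is a larger critical independent set
--    (critical-extension, beyond-bound, maxCritical-covers).
--  * Each v ∈ S lies in some B ∈ Γ′, hence in A ∪ N(A); as S ⊇ A is
--    independent, v ∉ N(A).  So S = A and A is a maximum independent set
--    (absorbed).
--  * A critical maximum independent A gives König–Egerváry: A dominates V,
--    Hall's theorem (proved here by induction, splitting at tight sets)
--    matches N(A) into A, and |I| + |M| ≤ n for every independent I and
--    matching M (critical-maximum⇒KE).

module Submission where

open import Defs
open import Data.Nat using (ℕ)
open import Data.Fin using (Fin)
open import Data.Fin.Subset using (Subset; _⊆_)
open import Data.Product using (_×_; ∃)
open import Function.Bundles using (_⇔_)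

open import Data.Nat using (zero; suc; _+_; _≤_; _<_; z≤n; s≤s; _≤?_; _<?_)
open import Data.Nat.Properties
  using ( +-0-commutativeMonoid; +-commutativeSemigroup; +-assoc; +-comm; +-identityʳ
        ; +-cancelˡ-≤; +-cancelʳ-≤; +-mono-≤; +-monoˡ-≤; +-monoʳ-≤; 0≢1+n; 1+n≰n; m<n+m; m≤m+n
        ; n≤0⇒n≡0; ≤-pred; ≤-refl; ≤-reflexive; ≤-trans; ≮⇒≥; ≰⇒>; module ≤-Reasoning )
open import Algebra.Properties.CommutativeSemigroup +-commutativeSemigroup using (xy∙z≈y∙xz; xy∙z≈y∙zx)
open import Algebra.Properties.CommutativeMonoid.Sum +-0-commutativeMonoid using (sum; ∑-distrib-+; sum-cong-≗)
open import Data.Integer as ℤ using (ℤ)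
import Data.Integer.Properties as ℤ
open import Data.Integer.Solver using (module +-*-Solver)
open import Data.Bool using (Bool; true; false; _∧_; _∨_; not; if_then_else_)
open import Data.Bool.Properties using (¬-not; ∧-zeroʳ; ∧-identityʳ) renaming (_≟_ to _≟ᵇ_)
open import Data.Fin using (_≟_) renaming (zero to 0F; suc to sucF)
open import Data.Fin.Subset using (_∈_; ∣_∣; inside; outside)
open import Data.Fin.Subset.Properties using (anySubset?; p⊆q⇒∣p∣≤∣q∣)
open import Data.Fin.Properties using (all?)
open import Data.Vec using ([]; _∷_; lookup; tabulate)
open import Data.Vec.Properties using (lookup∘tabulate; []=⇒lookup; lookup⇒[]=)
open import Data.List using (List; []; _∷_; _++_; length; map; concat)
open import Data.List.Properties using (length-++; length-map; concat-++; map-++)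
open import Data.List.Relation.Unary.All as All using (All; []; _∷_)
import Data.List.Relation.Unary.All.Properties as All
open import Data.List.Relation.Unary.Any using (here; there)
open import Data.List.Relation.Unary.AllPairs using ([]; _∷_)
open import Data.List.Relation.Unary.Unique.Propositional using (Unique)
import Data.List.Relation.Unary.Unique.Propositional.Properties as Unique
open import Data.List.Membership.Propositional using () renaming (_∈_ to _∈ₗ_)
open import Data.Product using (_,_; proj₁; proj₂)
open import Data.Sum using (_⊎_; inj₁; inj₂)
open import Data.Empty using (⊥; ⊥-elim)
open import Relation.Nullary using (Dec; yes; no; ¬_)
open import Relation.Nullary.Decidable using (does; dec-true; _×-dec_; _→-dec_)
open import Relation.Binary.PropositionalEquality as ≡ hiding (sym)
open import Function using (_∘_)
open import Function.Bundles using (mk⇔; Equivalence)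

∧-elimˡ : ∀ {x y} → x ∧ y ≡ true → x ≡ true
∧-elimˡ {true} _ = refl

∧-elimʳ : ∀ {x y} → x ∧ y ≡ true → y ≡ true
∧-elimʳ {true} e = e

∧-intro : ∀ {x y} → x ≡ true → y ≡ true → x ∧ y ≡ true
∧-intro refl refl = refl

∨-introˡ : ∀ {x y} → x ≡ true → x ∨ y ≡ true
∨-introˡ refl = refl

∨-introʳ : ∀ {x y} → y ≡ true → x ∨ y ≡ true
∨-introʳ {true} _ = refl
∨-introʳ {false} e = e

∨-elim : ∀ {x y} → x ∨ y ≡ true → x ≡ true ⊎ y ≡ true
∨-elim {true} _ = inj₁ refl
∨-elim {false} e = inj₂ e

not-true : ∀ {x} → not x ≡ true → x ≡ false
not-true {false} _ = refl

not-false : ∀ {x} → x ≡ false → not x ≡ true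
not-false refl = refl

true≢false : ∀ {x} → x ≡ true → x ≡ false → ⊥
true≢false refl ()

VSet : ℕ → Set
VSet n = Fin n → Bool

module _ {n : ℕ} where

  infixr 7 _∩_ _∖_
  infixr 6 _∪_
  infix 4 _⊑_

  _∩_ _∪_ _∖_ : VSet n → VSet n → VSet n
  (X ∩ Y) v = X v ∧ Y v
  (X ∪ Y) v = X v ∨ Y v
  (X ∖ Y) v = X v ∧ not (Y v)

  ⁅_⁆ : Fin n → VSet n
  ⁅ x ⁆ v = does (v ≟ x)

  _⊑_ : VSet n → VSet n → Set
  X ⊑ Y = ∀ v → X v ≡ true → Y v ≡ true

  Disjoint : VSet n → VSet n → Set
  Disjoint X Y = ∀ v → X v ≡ true → Y v ≡ false

  ⊑-trans : ∀ {X Y Z} → X ⊑ Y → Y ⊑ Z → X ⊑ Z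
  ⊑-trans X⊑Y Y⊑Z v = Y⊑Z v ∘ X⊑Y v

  ∪-least : ∀ {X Y Z} → X ⊑ Z → Y ⊑ Z → X ∪ Y ⊑ Z
  ∪-least {X} X⊑Z Y⊑Z v e with ∨-elim {X v} e
  ... | inj₁ Xv = X⊑Z v Xv
  ... | inj₂ Yv = Y⊑Z v Yv

  ∪-mono : ∀ {X X′ Y Y′} → X ⊑ X′ → Y ⊑ Y′ → X ∪ Y ⊑ X′ ∪ Y′
  ∪-mono {X′ = X′} X⊑X′ Y⊑Y′ = ∪-least (λ v → ∨-introˡ ∘ X⊑X′ v) (λ v → ∨-introʳ {X′ v} ∘ Y⊑Y′ v)

  #-sym : ∀ {X Y} → Disjoint X Y → Disjoint Y X
  #-sym X#Y v Yv = ¬-not λ Xv → true≢false Yv (X#Y v Xv)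

  #-⊑ : ∀ {X Y Z} → Disjoint X Y → Z ⊑ Y → Disjoint X Z
  #-⊑ X#Y Z⊑Y v Xv = ¬-not λ Zv → true≢false (Z⊑Y v Zv) (X#Y v Xv)

  ⁅⁆-self : (x : Fin n) → ⁅ x ⁆ x ≡ true
  ⁅⁆-self x = dec-true (x ≟ x) refl

  ⁅⁆-sound : ∀ {x v} → ⁅ x ⁆ v ≡ true → v ≡ x
  ⁅⁆-sound {x} {v} e with v ≟ x
  ... | yes v≡x = v≡x

ι : Bool → ℕ
ι true = 1
ι false = 0

count : ∀ {n} → VSet n → ℕ
count X = sum (λ v → ι (X v))

count-mono : ∀ {n} {X Y : VSet n} → X ⊑ Y → count X ≤ count Y
count-mono {zero} _ = z≤n
count-mono {suc n} X⊑Y = +-mono-≤ (ι-mono (X⊑Y 0F)) (count-mono (X⊑Y ∘ sucF))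
  where
    ι-mono : ∀ {x y} → (x ≡ true → y ≡ true) → ι x ≤ ι y
    ι-mono {false} _ = z≤n
    ι-mono {true} h rewrite h refl = ≤-refl

count-cong : ∀ {n} {X Y : VSet n} → X ≗ Y → count X ≡ count Y
count-cong X≗Y = sum-cong-≗ (cong ι ∘ X≗Y)

count-empty : ∀ {n} {X : VSet n} → (∀ v → X v ≡ false) → count X ≡ 0
count-empty {zero} _ = refl
count-empty {suc n} X≡∅ rewrite X≡∅ 0F = count-empty (X≡∅ ∘ sucF)

count-all : ∀ n → count {n} (λ _ → true) ≡ n
count-all zero = refl
count-all (suc n) = cong suc (count-all n)

count-∪-∩ : ∀ {n} (X Y : VSet n) → count (X ∪ Y) + count (X ∩ Y) ≡ count X + count Y
count-∪-∩ X Y = begin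
  count (X ∪ Y) + count (X ∩ Y)            ≡⟨ ∑-distrib-+ (λ v → ι ((X ∪ Y) v)) (λ v → ι ((X ∩ Y) v)) ⟨
  sum (λ v → ι ((X ∪ Y) v) + ι ((X ∩ Y) v)) ≡⟨ sum-cong-≗ (λ v → pointwise (X v) (Y v)) ⟩
  sum (λ v → ι (X v) + ι (Y v))             ≡⟨ ∑-distrib-+ (λ v → ι (X v)) (λ v → ι (Y v)) ⟩
  count X + count Y                          ∎
  where
    open ≡-Reasoning
    pointwise : ∀ x y → ι (x ∨ y) + ι (x ∧ y) ≡ ι x + ι y
    pointwise true true = refl
    pointwise true false = refl
    pointwise false true = refl
    pointwise false false = refl

count-∪-≤ : ∀ {n} (X Y : VSet n) → count (X ∪ Y) ≤ count X + count Y
count-∪-≤ X Y = subst (count (X ∪ Y) ≤_) (count-∪-∩ X Y) (m≤m+n _ _)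

count-∪-disjoint : ∀ {n} {X Y : VSet n} → Disjoint X Y → count (X ∪ Y) ≡ count X + count Y
count-∪-disjoint {X = X} {Y} X#Y = begin
  count (X ∪ Y)                  ≡⟨ +-identityʳ _ ⟨
  count (X ∪ Y) + 0              ≡⟨ cong (count (X ∪ Y) +_) (count-empty X∩Y≡∅) ⟨
  count (X ∪ Y) + count (X ∩ Y)  ≡⟨ count-∪-∩ X Y ⟩
  count X + count Y              ∎
  where
    open ≡-Reasoning
    X∩Y≡∅ : ∀ v → (X ∩ Y) v ≡ false
    X∩Y≡∅ v = ¬-not (λ e → true≢false (∧-elimʳ {X v} e) (X#Y v (∧-elimˡ e)))

count-disjoint-⊑ : ∀ {n} {X Y Z : VSet n} → Disjoint X Y → X ⊑ Z → Y ⊑ Z → count X + count Y ≤ count Z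
count-disjoint-⊑ X#Y X⊑Z Y⊑Z = subst (_≤ _) (count-∪-disjoint X#Y) (count-mono (∪-least X⊑Z Y⊑Z))

count-split : ∀ {n} (X Y : VSet n) → count X ≡ count (X ∩ Y) + count (X ∖ Y)
count-split X Y = trans (count-cong pieces) (count-∪-disjoint apart)
  where
    pieces : X ≗ (X ∩ Y) ∪ (X ∖ Y)
    pieces v with X v | Y v
    ... | true | true = refl
    ... | true | false = refl
    ... | false | _ = refl
    apart : Disjoint (X ∩ Y) (X ∖ Y)
    apart v e rewrite ∧-elimʳ {X v} e = ∧-zeroʳ (X v)

count-∖-< : ∀ {n} {X C : VSet n} → C ⊑ X → 0 < count C → count (X ∖ C) < count X
count-∖-< {X = X} {C} C⊑X pos = begin-strict
  count (X ∖ C)              <⟨ m<n+m _ pos ⟩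
  count C + count (X ∖ C)    ≡⟨ cong (_+ count (X ∖ C)) (count-cong X∩C≗C) ⟨
  count (X ∩ C) + count (X ∖ C) ≡⟨ count-split X C ⟨
  count X                    ∎
  where
    open ≤-Reasoning
    X∩C≗C : X ∩ C ≗ C
    X∩C≗C v with C v in Cv
    ... | true rewrite C⊑X v Cv = refl
    ... | false = ∧-zeroʳ (X v)

count-⁅⁆ : ∀ {n} (x : Fin n) → count ⁅ x ⁆ ≡ 1
count-⁅⁆ {suc n} 0F = cong suc (count-empty {X = λ (v : Fin n) → ⁅ 0F ⁆ (sucF v)} (λ _ → refl))
count-⁅⁆ {suc n} (sucF x) = count-⁅⁆ x

count-remove : ∀ {n} {X : VSet n} {x} → X x ≡ true → count X ≡ suc (count (X ∖ ⁅ x ⁆))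
count-remove {X = X} {x} x∈X = trans (count-split X ⁅ x ⁆) (cong (_+ count (X ∖ ⁅ x ⁆)) (trans (count-cong X∩x≗x) (count-⁅⁆ x)))
  where
    X∩x≗x : X ∩ ⁅ x ⁆ ≗ ⁅ x ⁆
    X∩x≗x v with v ≟ x
    ... | yes refl rewrite x∈X = refl
    ... | no _ = ∧-zeroʳ (X v)

count-complement : ∀ {n} (X : VSet n) → count X + count (not ∘ X) ≡ n
count-complement {n} X = trans (≡.sym (count-split (λ _ → true) X)) (count-all n)

count-insert : ∀ {n} {X : VSet n} {v} → X v ≡ false → count (X ∪ ⁅ v ⁆) ≡ suc (count X)
count-insert {X = X} {v} Xv = trans (count-∪-disjoint X#v) (trans (cong (count X +_) (count-⁅⁆ v)) (+-comm (count X) 1))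
  where
    X#v : Disjoint X ⁅ v ⁆
    X#v u Xu = ¬-not λ e → true≢false (subst (λ w → X w ≡ true) (⁅⁆-sound e) Xu) Xv

witness : ∀ {n} (X : VSet n) → 0 < count X → ∃ λ v → X v ≡ true
witness {suc n} X pos with X 0F in e
... | true = 0F , e
... | false = let (v , Xv) = witness (X ∘ sucF) pos in sucF v , Xv

∣∣-count : ∀ {n} (p : Subset n) → ∣ p ∣ ≡ count (lookup p)
∣∣-count [] = refl
∣∣-count (inside ∷ p) = cong suc (∣∣-count p)
∣∣-count (outside ∷ p) = ∣∣-count p

∣tabulate∣-count : ∀ {n} (X : VSet n) → ∣ tabulate X ∣ ≡ count X
∣tabulate∣-count X = trans (∣∣-count (tabulate X)) (count-cong (lookup∘tabulate X))

-- Existence of a member, with the same recursion as the (private)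
-- existential test used by Defs.N.
any : ∀ {m} → VSet m → Bool
any {zero} X = false
any {suc m} X = X 0F ∨ any (X ∘ sucF)

any-intro : ∀ {m} (X : VSet m) v → X v ≡ true → any X ≡ true
any-intro X 0F Xv rewrite Xv = refl
any-intro X (sucF v) Xv = ∨-introʳ {X 0F} (any-intro (X ∘ sucF) v Xv)

any-elim : ∀ {m} (X : VSet m) → any X ≡ true → ∃ λ v → X v ≡ true
any-elim {suc m} X e with ∨-elim {X 0F} e
... | inj₁ X0 = 0F , X0
... | inj₂ rest = let (v , Xv) = any-elim (X ∘ sucF) rest in sucF v , Xv

any-cong : ∀ {m} {X Y : VSet m} → X ≗ Y → any X ≡ any Y
any-cong {zero} _ = refl
any-cong {suc m} X≗Y = cong₂ _∨_ (X≗Y 0F) (any-cong (X≗Y ∘ sucF))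

-- The star on Fin (suc m) with centre 0F and leaves marked by F.  Reading
-- N at the centre makes Defs' private test appear on an arbitrary
-- predicate, which is how it is identified with any.
star : ∀ {m} → VSet m → Graph (suc m)
star F = record { adj = star-adj ; sym = star-sym ; irrefl = star-irrefl }
  where
    star-adj : Fin _ → Fin _ → Bool
    star-adj 0F (sucF j) = F j
    star-adj (sucF i) 0F = F i
    star-adj _ _ = false
    star-sym : ∀ u v → star-adj u v ≡ star-adj v u
    star-sym 0F 0F = refl
    star-sym 0F (sucF j) = refl
    star-sym (sucF i) 0F = refl
    star-sym (sucF i) (sucF j) = refl
    star-irrefl : ∀ v → star-adj v v ≡ false
    star-irrefl 0F = refl
    star-irrefl (sucF i) = refl

N-star-centre : ∀ {m} (A : Subset m) (F : VSet m) →
  lookup (N (star F) (outside ∷ A)) 0F ≡ any (lookup A ∩ F)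
N-star-centre [] F = refl
N-star-centre (a ∷ A) F = cong ((a ∧ F 0F) ∨_) (N-star-centre A (F ∘ sucF))

d-≤⇔ : ∀ a b c e → (ℤ.+ a ℤ.- ℤ.+ b ℤ.≤ ℤ.+ c ℤ.- ℤ.+ e) ⇔ (a + e ≤ c + b)
d-≤⇔ a b c e = mk⇔ to from
  where
    open +-*-Solver
    K : ℤ
    K = ℤ.+ b ℤ.+ ℤ.+ e
    left : (ℤ.+ a ℤ.- ℤ.+ b) ℤ.+ K ≡ ℤ.+ (a + e)
    left = trans (solve 3 (λ x y z → (x :- y) :+ (y :+ z) := x :+ z) refl (ℤ.+ a) (ℤ.+ b) (ℤ.+ e))
                 (≡.sym (ℤ.pos-+ a e))
    right : (ℤ.+ c ℤ.- ℤ.+ e) ℤ.+ K ≡ ℤ.+ (c + b)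
    right = trans (solve 3 (λ x y z → (x :- z) :+ (y :+ z) := x :+ y) refl (ℤ.+ c) (ℤ.+ b) (ℤ.+ e))
                  (≡.sym (ℤ.pos-+ c b))
    unshift : ∀ i → (i ℤ.+ K) ℤ.+ ℤ.- K ≡ i
    unshift i = solve 2 (λ x k → (x :+ k) :+ (:- k) := x) refl i K
    to : ℤ.+ a ℤ.- ℤ.+ b ℤ.≤ ℤ.+ c ℤ.- ℤ.+ e → a + e ≤ c + b
    to h = ℤ.drop‿+≤+ (subst₂ ℤ._≤_ left right (ℤ.+-monoˡ-≤ K h))
    from : a + e ≤ c + b → ℤ.+ a ℤ.- ℤ.+ b ℤ.≤ ℤ.+ c ℤ.- ℤ.+ e
    from h = subst₂ ℤ._≤_ (unshift _) (unshift _)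
      (ℤ.+-monoˡ-≤ (ℤ.- K) (subst₂ ℤ._≤_ (≡.sym left) (≡.sym right) (ℤ.+≤+ h)))

module _ {n : ℕ} (G : Graph n) where

  adj-sym : ∀ {u v} → adj G u v ≡ true → adj G v u ≡ true
  adj-sym {u} {v} e = trans (Graph.sym G v u) e

  nb : VSet n → VSet n
  nb X v = any (X ∩ adj G v)

  nb-intro : ∀ {X u v} → X u ≡ true → adj G v u ≡ true → nb X v ≡ true
  nb-intro {X} {u} {v} Xu uv = any-intro (X ∩ adj G v) u (∧-intro Xu uv)

  nb-elim : ∀ {X v} → nb X v ≡ true → ∃ λ u → X u ≡ true × adj G v u ≡ true
  nb-elim {X} {v} e = let (u , p) = any-elim (X ∩ adj G v) e in u , ∧-elimˡ p , ∧-elimʳ {X u} p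

  nb-mono : ∀ {X Y} → X ⊑ Y → nb X ⊑ nb Y
  nb-mono X⊑Y v e = let (u , Xu , vu) = nb-elim e in nb-intro (X⊑Y u Xu) vu

  nb-cong : ∀ {X Y} → X ≗ Y → nb X ≗ nb Y
  nb-cong X≗Y v = any-cong (λ u → cong (_∧ adj G v u) (X≗Y u))

  lookup-N : ∀ A v → lookup (N G A) v ≡ nb (lookup A) v
  lookup-N A v = trans (lookup∘tabulate _ v) (N-star-centre A (adj G v))

  lookup-N-tabulate : ∀ X v → lookup (N G (tabulate X)) v ≡ nb X v
  lookup-N-tabulate X v = trans (lookup-N (tabulate X) v) (nb-cong (lookup∘tabulate X) v)

  ∣N∣-count : ∀ A → ∣ N G A ∣ ≡ count (nb (lookup A))
  ∣N∣-count A = trans (∣∣-count (N G A)) (count-cong (lookup-N A))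

  ∣N-tabulate∣-count : ∀ X → ∣ N G (tabulate X) ∣ ≡ count (nb X)
  ∣N-tabulate∣-count X = trans (∣∣-count (N G (tabulate X))) (count-cong (lookup-N-tabulate X))

  Indep : VSet n → Set
  Indep X = ∀ u v → X u ≡ true → X v ≡ true → adj G u v ≡ false

  indep-lookup : ∀ {A} → Independent G A → Indep (lookup A)
  indep-lookup {A} h u v Au Av = h u v (lookup⇒[]= u A Au) (lookup⇒[]= v A Av)

  indep-tabulate : ∀ {X} → Indep X → Independent G (tabulate X)
  indep-tabulate {X} h u v u∈ v∈ = h u v (member u u∈) (member v v∈)
    where
      member : ∀ w → w ∈ tabulate X → X w ≡ true
      member w w∈ = trans (≡.sym (lookup∘tabulate X w)) ([]=⇒lookup w∈)

  indep-nb-disjoint : ∀ {X} → Indep X → Disjoint X (nb X)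
  indep-nb-disjoint {X} h v Xv = ¬-not λ e → let (u , Xu , vu) = nb-elim e in true≢false vu (h v u Xv Xu)

  indep-mono : ∀ {X Y} → X ⊑ Y → Indep Y → Indep X
  indep-mono X⊑Y h u v Xu Xv = h u v (X⊑Y u Xu) (X⊑Y v Xv)

  critical-bound : ∀ {A} → Critical G A → ∀ {I} → Indep I →
    count I + count (nb (lookup A)) ≤ count (lookup A) + count (nb I)
  critical-bound {A} (_ , best) {I} indepI =
    subst₂ _≤_ (cong₂ _+_ (∣tabulate∣-count I) (∣N∣-count A)) (cong₂ _+_ (∣∣-count A) (∣N-tabulate∣-count I))
      (Equivalence.to (d-≤⇔ (∣ tabulate I ∣) (∣ N G (tabulate I) ∣) (∣ A ∣) (∣ N G A ∣)) (best (tabulate I) (indep-tabulate indepI)))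

  critical-by-bound : ∀ {A} → Critical G A → ∀ {Z} → Indep Z →
    count (lookup A) + count (nb Z) ≤ count Z + count (nb (lookup A)) → Critical G (tabulate Z)
  critical-by-bound {A} (_ , best) {Z} indepZ better = indep-tabulate indepZ , λ I indepI →
    ℤ.≤-trans (best I indepI) (Equivalence.from (d-≤⇔ (∣ A ∣) (∣ N G A ∣) (∣ tabulate Z ∣) (∣ N G (tabulate Z) ∣))
      (subst₂ _≤_ (cong₂ _+_ (≡.sym (∣∣-count A)) (≡.sym (∣N-tabulate∣-count Z)))
                  (cong₂ _+_ (≡.sym (∣tabulate∣-count Z)) (≡.sym (∣N∣-count A))) better))

  -- Otherwise removing
  -- from A the neighbours of C would increase the difference.
  critical-hall : ∀ {A} → Critical G A → ∀ C → C ⊑ nb (lookup A) → count C ≤ count (lookup A ∩ nb C)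
  critical-hall {A} critA C C⊑NA = +-cancelˡ-≤ (count (nb A′)) _ _ (begin
    count (nb A′) + count C            ≤⟨ count-disjoint-⊑ NA′#C (nb-mono (λ _ → ∧-elimˡ)) C⊑NA ⟩
    count (nb a)                       ≤⟨ NA-bound ⟩
    count (a ∩ nb C) + count (nb A′)   ≡⟨ +-comm (count (a ∩ nb C)) _ ⟩
    count (nb A′) + count (a ∩ nb C)   ∎)
    where
      open ≤-Reasoning
      a A′ : VSet n
      a = lookup A
      A′ = a ∖ nb C
      A′-indep : Indep A′
      A′-indep = indep-mono (λ _ → ∧-elimˡ) (indep-lookup (proj₁ critA))
      NA′#C : Disjoint (nb A′) C
      NA′#C v e = ¬-not λ Cv → let (u , A′u , vu) = nb-elim e in
        true≢false (nb-intro Cv (adj-sym vu)) (not-true (∧-elimʳ {a u} A′u))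
      -- Criticality of A against A′, using |A| = |A ∩ N(C)| + |A′|.
      NA-bound : count (nb a) ≤ count (a ∩ nb C) + count (nb A′)
      NA-bound = +-cancelˡ-≤ (count A′) _ _ (subst (count A′ + count (nb a) ≤_)
        (trans (cong (_+ count (nb A′)) (count-split a (nb C))) (xy∙z≈y∙xz (count (a ∩ nb C)) _ _))
        (critical-bound critA A′-indep))

  indep-∪ : ∀ {X Y} → Indep X → Indep Y → Disjoint Y (nb X) → Indep (X ∪ Y)
  indep-∪ {X} {Y} indX indY Y#NX u v Zu Zv with ∨-elim {X u} Zu | ∨-elim {X v} Zv
  ... | inj₁ Xu | inj₁ Xv = indX u v Xu Xv
  ... | inj₂ Yu | inj₂ Yv = indY u v Yu Yv
  ... | inj₁ Xu | inj₂ Yv = ¬-not λ uv → true≢false (nb-intro Xu (adj-sym uv)) (Y#NX v Yv)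
  ... | inj₂ Yu | inj₁ Xv = ¬-not λ uv → true≢false (nb-intro Xv uv) (Y#NX u Yu)

  beyond : VSet n → VSet n → VSet n
  beyond X Y = (Y ∖ X) ∖ nb X

  beyond-⊑ : ∀ X Y → beyond X Y ⊑ Y
  beyond-⊑ X Y v = ∧-elimˡ ∘ ∧-elimˡ

  beyond-#X : ∀ X Y → Disjoint (beyond X Y) X
  beyond-#X X Y v e = not-true (∧-elimʳ {Y v} (∧-elimˡ e))

  beyond-#N : ∀ X Y → Disjoint (beyond X Y) (nb X)
  beyond-#N X Y v e = not-true (∧-elimʳ {(Y ∖ X) v} e)

  nb-∪⊑ : ∀ {X Y} → Disjoint Y (nb X) → nb (X ∪ Y) ⊑ nb X ∪ beyond X (nb Y)
  nb-∪⊑ {X} {Y} Y#NX v e with nb X v in NXv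
  ... | true = refl
  ... | false with nb-elim e
  ...   | u , Zu , vu with ∨-elim {X u} Zu
  ...     | inj₁ Xu = ⊥-elim (true≢false (nb-intro Xu vu) NXv)
  ...     | inj₂ Yu = ∧-intro (∧-intro (nb-intro Yu vu) (not-false X∌v)) refl
    where
      X∌v : X v ≡ false
      X∌v = ¬-not λ Xv → true≢false (nb-intro Xv (adj-sym vu)) (Y#NX u Yu)

  critical-extension : ∀ {A} → Critical G A → ∀ {B₁} → Indep B₁ →
    Disjoint B₁ (lookup A) → Disjoint B₁ (nb (lookup A)) →
    count (beyond (lookup A) (nb B₁)) ≤ count B₁ → Critical G (tabulate (lookup A ∪ B₁))
  critical-extension {A} critA {B₁} indB₁ B₁#A B₁#NA few =
    critical-by-bound critA (indep-∪ (indep-lookup (proj₁ critA)) indB₁ B₁#NA) (begin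
      count a + count (nb (a ∪ B₁))       ≤⟨ +-monoʳ-≤ (count a) (count-mono (nb-∪⊑ B₁#NA)) ⟩
      count a + count (nb a ∪ X₁)         ≤⟨ +-monoʳ-≤ (count a) (count-∪-≤ (nb a) X₁) ⟩
      count a + (count (nb a) + count X₁) ≤⟨ +-monoʳ-≤ (count a) (+-monoʳ-≤ (count (nb a)) few) ⟩
      count a + (count (nb a) + count B₁) ≡⟨ cong (count a +_) (+-comm (count (nb a)) _) ⟩
      count a + (count B₁ + count (nb a)) ≡⟨ +-assoc (count a) _ _ ⟨
      count a + count B₁ + count (nb a)   ≡⟨ cong (_+ count (nb a)) (count-∪-disjoint (#-sym B₁#A)) ⟨
      count (a ∪ B₁) + count (nb a)       ∎)
    where
      open ≤-Reasoning
      a X₁ : VSet n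
      a = lookup A
      X₁ = beyond a (nb B₁)

  -- Write B = T ⊔ Bₙ ⊔ B₁ with T ⊆ A
  -- and Bₙ ⊆ N(A).  N(B) contains the disjoint sets X₁ (neighbours of B₁
  -- beyond A), N(T) ⊆ N(A) and X₃ = A ∩ N(Bₙ), and |Bₙ| ≤ |X₃| by the Hall
  -- property of A; criticality of B against T then bounds |X₁| by |B₁|.
  beyond-bound : ∀ {A B} → Critical G A → Critical G B →
    count (beyond (lookup A) (nb (beyond (lookup A) (lookup B)))) ≤ count (beyond (lookup A) (lookup B))
  beyond-bound {A} {B} critA critB = +-cancelʳ-≤ (count (nb T) + count X₃) _ _ (begin
    count X₁ + (count (nb T) + count X₃)  ≤⟨ NB-room ⟩
    count (nb b)                          ≤⟨ NB-bound ⟩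
    count Bₙ + count B₁ + count (nb T)    ≤⟨ +-monoˡ-≤ (count (nb T)) (+-monoˡ-≤ (count B₁) Bₙ≤X₃) ⟩
    count X₃ + count B₁ + count (nb T)    ≡⟨ xy∙z≈y∙zx (count X₃) _ _ ⟩
    count B₁ + (count (nb T) + count X₃)  ∎)
    where
      open ≤-Reasoning
      a b T Bₙ B₁ X₁ X₃ : VSet n
      a = lookup A
      b = lookup B
      T = b ∩ a
      Bₙ = (b ∖ a) ∩ nb a
      B₁ = beyond a b
      X₁ = beyond a (nb B₁)
      X₃ = a ∩ nb Bₙ
      a#Na : Disjoint a (nb a)
      a#Na = indep-nb-disjoint (indep-lookup (proj₁ critA))
      Bₙ≤X₃ : count Bₙ ≤ count X₃
      Bₙ≤X₃ = critical-hall critA Bₙ (λ _ → ∧-elimʳ)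
      B-split : count b ≡ count T + (count Bₙ + count B₁)
      B-split = trans (count-split b a) (cong (count T +_) (count-split (b ∖ a) (nb a)))
      NT⊑Na : nb T ⊑ nb a
      NT⊑Na = nb-mono (λ _ → ∧-elimʳ)
      -- X₁ avoids A ∪ N(A), which contains N(T) ∪ X₃; and N(T) ⊆ N(A) avoids X₃ ⊆ A.
      X₁#a∪Na : Disjoint X₁ (nb a ∪ a)
      X₁#a∪Na v X₁v rewrite beyond-#N a (nb B₁) v X₁v = beyond-#X a (nb B₁) v X₁v
      NT#X₃ : Disjoint (nb T) X₃
      NT#X₃ = #-⊑ (#-sym (#-⊑ a#Na NT⊑Na)) (λ _ → ∧-elimˡ)
      NB-room : count X₁ + (count (nb T) + count X₃) ≤ count (nb b)
      NB-room = subst (_≤ count (nb b)) (cong (count X₁ +_) (count-∪-disjoint NT#X₃))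
        (count-disjoint-⊑ (#-⊑ X₁#a∪Na (∪-mono NT⊑Na (λ _ → ∧-elimˡ)))
          (⊑-trans (beyond-⊑ a (nb B₁)) (nb-mono (beyond-⊑ a b)))
          (∪-least (nb-mono (λ _ → ∧-elimˡ)) (λ v → nb-mono (λ _ → ∧-elimˡ ∘ ∧-elimˡ) v ∘ ∧-elimʳ {a v})))
      -- Criticality of B against its part T.
      NB-bound : count (nb b) ≤ count Bₙ + count B₁ + count (nb T)
      NB-bound = +-cancelˡ-≤ (count T) _ _ (subst (count T + count (nb b) ≤_)
        (trans (cong (_+ count (nb T)) B-split) (+-assoc (count T) _ _))
        (critical-bound critB (indep-mono (λ _ → ∧-elimʳ) (indep-lookup (proj₁ critA)))))

  -- Covering: a maximum critical independent set A absorbs every critical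
  -- independent set into A ∪ N(A); otherwise A ∪ beyond A B would be a
  -- larger critical independent set.
  maxCritical-covers : ∀ {A B} → MaxCritical G A → Critical G B → lookup B ⊑ lookup A ∪ nb (lookup A)
  maxCritical-covers {A} {B} (critA , largest) critB v Bv with lookup A v in Av | nb (lookup A) v in NAv
  ... | true | _ = refl
  ... | false | true = refl
  ... | false | false = ⊥-elim (0≢1+n (trans (≡.sym nothing-beyond) (count-remove {X = B₁} B₁v)))
    where
      a B₁ : VSet n
      a = lookup A
      B₁ = beyond a (lookup B)
      B₁v : B₁ v ≡ true
      B₁v = ∧-intro (∧-intro Bv (not-false Av)) (not-false NAv)
      bigger : Critical G (tabulate (a ∪ B₁))
      bigger = critical-extension critA (indep-mono (beyond-⊑ a (lookup B)) (indep-lookup (proj₁ critB)))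
        (beyond-#X a (lookup B)) (beyond-#N a (lookup B)) (beyond-bound critA critB)
      nothing-beyond : count B₁ ≡ 0
      nothing-beyond = n≤0⇒n≡0 (+-cancelˡ-≤ (count a) _ _ (begin
        count a + count B₁        ≡⟨ count-∪-disjoint (#-sym (beyond-#X a (lookup B))) ⟨
        count (a ∪ B₁)            ≡⟨ ∣tabulate∣-count (a ∪ B₁) ⟨
        ∣ tabulate (a ∪ B₁) ∣     ≤⟨ largest _ bigger ⟩
        ∣ A ∣                     ≡⟨ ∣∣-count A ⟩
        count a                   ≡⟨ +-identityʳ (count a) ⟨
        count a + 0               ∎))
        where open ≤-Reasoning

  EdgesFromTo : VSet n → VSet n → List (Fin n × Fin n) → Set
  EdgesFromTo X Y = All (λ e → X (proj₁ e) ≡ true × Y (proj₂ e) ≡ true)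

  record MatchingInto (X Y : VSet n) : Set where
    field
      edges      : List (Fin n × Fin n)
      matching   : Matching G edges
      from-to    : EdgesFromTo X Y edges
      saturating : length edges ≡ count X
  open MatchingInto

  endpoints-++ : ∀ M₁ M₂ → endpoints G (M₁ ++ M₂) ≡ endpoints G M₁ ++ endpoints G M₂
  endpoints-++ M₁ M₂ = trans (cong concat (map-++ _ M₁ M₂)) (≡.sym (concat-++ (map _ M₁) (map _ M₂)))

  endpoint-in : ∀ {X Y} M → EdgesFromTo X Y M → ∀ {w} → w ∈ₗ endpoints G M → (X ∪ Y) w ≡ true
  endpoint-in (e ∷ M) ((Xe , _) ∷ _) (here refl) = ∨-introˡ Xe
  endpoint-in {X} (e ∷ M) ((_ , Ye) ∷ _) (there (here refl)) = ∨-introʳ {X (proj₂ e)} Ye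
  endpoint-in (e ∷ M) (_ ∷ rest) (there (there w∈)) = endpoint-in M rest w∈

  retarget : ∀ {X X′ Y Y′} → X ≗ X′ → Y ⊑ Y′ → MatchingInto X Y → MatchingInto X′ Y′
  retarget X≗X′ Y⊑Y′ μ = record
    { edges = edges μ
    ; matching = matching μ
    ; from-to = All.map (λ { (Xe , Ye) → trans (≡.sym (X≗X′ _)) Xe , Y⊑Y′ _ Ye }) (from-to μ)
    ; saturating = trans (saturating μ) (count-cong X≗X′) }

  matching-union : ∀ {X₁ Y₁ X₂ Y₂} → Disjoint (X₁ ∪ Y₁) (X₂ ∪ Y₂) →
    MatchingInto X₁ Y₁ → MatchingInto X₂ Y₂ → MatchingInto (X₁ ∪ X₂) (Y₁ ∪ Y₂)
  matching-union {X₁} {Y₁} {X₂} {Y₂} apart μ₁ μ₂ = record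
    { edges = edges μ₁ ++ edges μ₂
    ; matching = All.++⁺ (proj₁ (matching μ₁)) (proj₁ (matching μ₂)) ,
        subst Unique (≡.sym (endpoints-++ (edges μ₁) (edges μ₂)))
          (Unique.++⁺ (proj₂ (matching μ₁)) (proj₂ (matching μ₂))
            λ (w∈₁ , w∈₂) → true≢false (endpoint-in _ (from-to μ₂) w∈₂)
                                       (apart _ (endpoint-in _ (from-to μ₁) w∈₁)))
    ; from-to = All.++⁺ (All.map (λ { (Xe , Ye) → ∨-introˡ Xe , ∨-introˡ Ye }) (from-to μ₁))
                        (All.map (λ { {e} (Xe , Ye) → ∨-introʳ {X₁ (proj₁ e)} Xe , ∨-introʳ {Y₁ (proj₂ e)} Ye }) (from-to μ₂))
    ; saturating = trans (length-++ (edges μ₁)) (trans (cong₂ _+_ (saturating μ₁) (saturating μ₂))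
                     (≡.sym (count-∪-disjoint X₁#X₂))) }
    where
      X₁#X₂ : Disjoint X₁ X₂
      X₁#X₂ = #-⊑ (λ v → apart v ∘ ∨-introˡ) (λ _ → ∨-introˡ)

  matching-cons : ∀ {X Y x y} → Disjoint X Y → X x ≡ true → Y y ≡ true → adj G x y ≡ true →
    MatchingInto (X ∖ ⁅ x ⁆) (Y ∖ ⁅ y ⁆) → MatchingInto X Y
  matching-cons {X} {Y} {x} {y} X#Y Xx Yy xy μ = record
    { edges = (x , y) ∷ edges μ
    ; matching = xy ∷ proj₁ (matching μ) ,
        (x≢y ∷ All.tabulate (fresh x⁻)) ∷ All.tabulate (fresh y⁻) ∷ proj₂ (matching μ)
    ; from-to = (Xx , Yy) ∷ All.map (λ { (Xe , Ye) → ∧-elimˡ Xe , ∧-elimˡ Ye }) (from-to μ)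
    ; saturating = trans (cong suc (saturating μ)) (≡.sym (count-remove {X = X} Xx)) }
    where
      x≢y : x ≢ y
      x≢y refl = true≢false Yy (X#Y x Xx)
      x⁻ : ((X ∖ ⁅ x ⁆) ∪ (Y ∖ ⁅ y ⁆)) x ≡ false
      x⁻ rewrite Xx | ⁅⁆-self x | X#Y x Xx = refl
      y⁻ : ((X ∖ ⁅ x ⁆) ∪ (Y ∖ ⁅ y ⁆)) y ≡ false
      y⁻ rewrite #-sym X#Y y Yy | Yy | ⁅⁆-self y = refl
      fresh : ∀ {z} → ((X ∖ ⁅ x ⁆) ∪ (Y ∖ ⁅ y ⁆)) z ≡ false → ∀ {w} → w ∈ₗ endpoints G (edges μ) → z ≢ w
      fresh z⁻ w∈ refl = true≢false (endpoint-in _ (from-to μ) w∈) z⁻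

  HallCondition : VSet n → VSet n → Set
  HallCondition X Y = ∀ C → C ⊑ X → count C ≤ count (Y ∩ nb C)

  Tight : VSet n → VSet n → VSet n → Set
  Tight X Y C = C ⊑ X × 0 < count C × count C < count X × count (Y ∩ nb C) ≤ count C

  tight? : ∀ X Y (p : Subset n) → Dec (Tight X Y (lookup p))
  tight? X Y p = all? (λ v → (lookup p v ≟ᵇ true) →-dec (X v ≟ᵇ true))
    ×-dec (0 <? count C) ×-dec (count C <? count X) ×-dec (count (Y ∩ nb C) ≤? count C)
    where
      C : VSet n
      C = lookup p

  -- tightness transfers to the Subset representing C, so the search over Subsets is exhaustive
  tight-tabulate : ∀ {X Y C} → Tight X Y C → Tight X Y (lookup (tabulate C))
  tight-tabulate {X} {Y} {C} (C⊑X , pos , proper , few) =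
    (λ v e → C⊑X v (trans (≡.sym (lookup∘tabulate C v)) e)) ,
    subst (0 <_) (≡.sym same) pos ,
    subst (_< count X) (≡.sym same) proper ,
    subst₂ _≤_ (count-cong (λ v → cong (Y v ∧_) (≡.sym (nb-cong (lookup∘tabulate C) v)))) (≡.sym same) few
    where
      same : count (lookup (tabulate C)) ≡ count C
      same = count-cong (lookup∘tabulate C)

  nb-∪ : ∀ {C D} → nb (C ∪ D) ⊑ nb C ∪ nb D
  nb-∪ {C} {D} v e with nb-elim e
  ... | u , CDu , vu with ∨-elim {C u} CDu
  ...   | inj₁ Cu = ∨-introˡ (nb-intro Cu vu)
  ...   | inj₂ Du = ∨-introʳ {nb C v} (nb-intro Du vu)

  hall-inside : ∀ {X Y C} → HallCondition X Y → C ⊑ X → HallCondition C (Y ∩ nb C)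
  hall-inside {Y = Y} {C} hallXY C⊑X D D⊑C = ≤-trans (hallXY D (⊑-trans D⊑C C⊑X))
    (count-mono λ v e → ∧-intro (∧-intro (∧-elimˡ e) (nb-mono D⊑C v (∧-elimʳ {Y v} e))) (∧-elimʳ {Y v} e))

  -- Outside a tight set C, Hall's condition holds towards Y ∖ N(C): each D
  -- disjoint from C gains at most |C| extra neighbours by adding C.
  hall-outside : ∀ {X Y C} → HallCondition X Y → C ⊑ X → count (Y ∩ nb C) ≤ count C →
    HallCondition (X ∖ C) (Y ∖ nb C)
  hall-outside {X} {Y} {C} hallXY C⊑X few D D⊑X∖C = +-cancelʳ-≤ (count C) _ _ (begin
    count D + count C                          ≡⟨ count-∪-disjoint D#C ⟨
    count (D ∪ C)                              ≤⟨ hallXY (D ∪ C) D∪C⊑X ⟩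
    count (Y ∩ nb (D ∪ C))                     ≤⟨ count-mono split ⟩
    count ((Y ∖ nb C) ∩ nb D ∪ Y ∩ nb C)       ≤⟨ count-∪-≤ ((Y ∖ nb C) ∩ nb D) (Y ∩ nb C) ⟩
    count ((Y ∖ nb C) ∩ nb D) + count (Y ∩ nb C) ≤⟨ +-monoʳ-≤ (count ((Y ∖ nb C) ∩ nb D)) few ⟩
    count ((Y ∖ nb C) ∩ nb D) + count C        ∎)
    where
      open ≤-Reasoning
      D#C : Disjoint D C
      D#C v Dv = not-true (∧-elimʳ {X v} (D⊑X∖C v Dv))
      D∪C⊑X : (D ∪ C) ⊑ X
      D∪C⊑X = ∪-least (λ v → ∧-elimˡ ∘ D⊑X∖C v) C⊑X
      split : Y ∩ nb (D ∪ C) ⊑ (Y ∖ nb C) ∩ nb D ∪ Y ∩ nb C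
      split v e with nb C v in NCv | ∨-elim {nb D v} (nb-∪ v (∧-elimʳ {Y v} e))
      ... | true | _ = ∨-introʳ {(Y v ∧ not true) ∧ nb D v} (∧-intro (∧-elimˡ {Y v} e) refl)
      ... | false | inj₁ NDv = ∨-introˡ (∧-intro (∧-intro (∧-elimˡ {Y v} e) refl) NDv)
      ... | false | inj₂ ()

  -- Without tight sets, removing an edge xy keeps Hall's condition: every
  -- nonempty D ⊆ X ∖ {x} had more than |D| neighbours in Y, and loses at most y.
  hall-without-edge : ∀ {X Y x y} → HallCondition X Y → (∀ C → ¬ Tight X Y C) → X x ≡ true →
    HallCondition (X ∖ ⁅ x ⁆) (Y ∖ ⁅ y ⁆)
  hall-without-edge {X} {Y} {x} {y} hallXY loose Xx D D⊑X′ with 0 <? count D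
  ... | no empty = ≤-trans (≮⇒≥ empty) z≤n
  ... | yes nonempty = ≤-pred (begin
    suc (count D)                         ≤⟨ ≰⇒> (λ few → loose D (D⊑X , nonempty , proper , few)) ⟩
    count (Y ∩ nb D)                      ≤⟨ count-mono lose-y ⟩
    count ((Y ∖ ⁅ y ⁆) ∩ nb D ∪ ⁅ y ⁆)    ≤⟨ count-∪-≤ ((Y ∖ ⁅ y ⁆) ∩ nb D) ⁅ y ⁆ ⟩
    count ((Y ∖ ⁅ y ⁆) ∩ nb D) + count ⁅ y ⁆ ≡⟨ cong (count ((Y ∖ ⁅ y ⁆) ∩ nb D) +_) (count-⁅⁆ y) ⟩
    count ((Y ∖ ⁅ y ⁆) ∩ nb D) + 1        ≡⟨ +-comm _ 1 ⟩
    suc (count ((Y ∖ ⁅ y ⁆) ∩ nb D))      ∎)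
    where
      open ≤-Reasoning
      D⊑X : D ⊑ X
      D⊑X v = ∧-elimˡ ∘ D⊑X′ v
      proper : count D < count X
      proper = subst (count D <_) (≡.sym (count-remove {X = X} Xx)) (s≤s (count-mono D⊑X′))
      lose-y : Y ∩ nb D ⊑ (Y ∖ ⁅ y ⁆) ∩ nb D ∪ ⁅ y ⁆
      lose-y v e with ⁅ y ⁆ v
      ... | true = ∨-introʳ {_} refl
      ... | false = ∨-introˡ (∧-intro (∧-intro (∧-elimˡ {Y v} e) refl) (∧-elimʳ {Y v} e))

  empty-matching : ∀ {X Y} → count X ≡ 0 → MatchingInto X Y
  empty-matching none = record { edges = [] ; matching = [] , [] ; from-to = [] ; saturating = ≡.sym none }

  Hall≤ : ℕ → Set
  Hall≤ k = ∀ {X Y} → count X ≤ k → Disjoint X Y → HallCondition X Y → MatchingInto X Y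

  -- Induction step at a tight set C: match C into Y ∩ N(C) and X ∖ C into
  -- Y ∖ N(C), both smaller instances, and combine.
  hall-tight : ∀ {k} → Hall≤ k → ∀ {X Y C} → count X ≤ suc k → Disjoint X Y → HallCondition X Y →
    Tight X Y C → MatchingInto X Y
  hall-tight hall≤k {X} {Y} {C} small X#Y hallXY (C⊑X , nonempty , proper , few) =
    retarget reassemble Y-side (matching-union apart
      (hall≤k (≤-pred (≤-trans proper small)) inner-# (hall-inside hallXY C⊑X))
      (hall≤k (≤-pred (≤-trans (count-∖-< C⊑X nonempty) small)) outer-# (hall-outside hallXY C⊑X few)))
    where
      inner-# : Disjoint C (Y ∩ nb C)
      inner-# v Cv = cong (_∧ nb C v) (X#Y v (C⊑X v Cv))
      outer-# : Disjoint (X ∖ C) (Y ∖ nb C)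
      outer-# v e = cong (_∧ not (nb C v)) (X#Y v (∧-elimˡ e))
      apart : Disjoint (C ∪ Y ∩ nb C) ((X ∖ C) ∪ (Y ∖ nb C))
      apart v e with ∨-elim {C v} e
      ... | inj₁ Cv rewrite Cv | ∧-zeroʳ (X v) | X#Y v (C⊑X v Cv) = refl
      ... | inj₂ YNCv rewrite ∧-elimʳ {Y v} YNCv | #-sym X#Y v (∧-elimˡ YNCv) | ∧-zeroʳ (Y v) = refl
      reassemble : C ∪ (X ∖ C) ≗ X
      reassemble v with C v in Cv
      ... | true = ≡.sym (C⊑X v Cv)
      ... | false = ∧-identityʳ (X v)
      Y-side : (Y ∩ nb C) ∪ (Y ∖ nb C) ⊑ Y
      Y-side = ∪-least (λ _ → ∧-elimˡ) (λ _ → ∧-elimˡ)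

  -- Induction step without tight sets: match some x ∈ X to a neighbour
  -- y ∈ Y and recurse on X ∖ {x}, Y ∖ {y}.
  hall-loose : ∀ {k} → Hall≤ k → ∀ {X Y} → count X ≤ suc k → Disjoint X Y → HallCondition X Y →
    (∀ C → ¬ Tight X Y C) → MatchingInto X Y
  hall-loose {k} hall≤k {X} {Y} small X#Y hallXY loose with 0 <? count X
  ... | no empty = empty-matching (n≤0⇒n≡0 (≮⇒≥ empty))
  ... | yes nonempty = extend (witness X nonempty)
    where
      extend : (∃ λ x → X x ≡ true) → MatchingInto X Y
      extend (x , Xx) = matching-cons X#Y Xx Yy (adj-sym y~x)
          (hall≤k smaller rest-# (hall-without-edge hallXY loose Xx))
        where
          x⊑X : ⁅ x ⁆ ⊑ X
          x⊑X v e = subst (λ w → X w ≡ true) (≡.sym (⁅⁆-sound e)) Xx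
          x-has-neighbour : 0 < count (Y ∩ nb ⁅ x ⁆)
          x-has-neighbour = ≤-trans (≤-reflexive (≡.sym (count-⁅⁆ x))) (hallXY ⁅ x ⁆ x⊑X)
          neighbour : ∃ λ y → (Y ∩ nb ⁅ x ⁆) y ≡ true
          neighbour = witness (Y ∩ nb ⁅ x ⁆) x-has-neighbour
          y : Fin n
          y = proj₁ neighbour
          Yy : Y y ≡ true
          Yy = ∧-elimˡ (proj₂ neighbour)
          y~x : adj G y x ≡ true
          y~x with nb-elim (∧-elimʳ {Y y} (proj₂ neighbour))
          ... | u , xu , yu = subst (λ w → adj G y w ≡ true) (⁅⁆-sound xu) yu
          smaller : count (X ∖ ⁅ x ⁆) ≤ k
          smaller = ≤-pred (subst (_≤ suc k) (count-remove {X = X} Xx) small)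
          rest-# : Disjoint (X ∖ ⁅ x ⁆) (Y ∖ ⁅ y ⁆)
          rest-# v e = cong (_∧ not (⁅ y ⁆ v)) (X#Y v (∧-elimˡ e))

  hall : ∀ k → Hall≤ k
  hall zero small _ _ = empty-matching (n≤0⇒n≡0 small)
  hall (suc k) {X} {Y} small X#Y hallXY with anySubset? (tight? X Y)
  ... | yes (p , tight) = hall-tight (hall k) small X#Y hallXY tight
  ... | no none = hall-loose (hall k) small X#Y hallXY (λ C tight → none (tabulate C , tight-tabulate tight))

  unique-length : ∀ {P : VSet n} L → Unique L → All (λ w → P w ≡ true) L → length L ≤ count P
  unique-length [] _ _ = z≤n
  unique-length {P} (x ∷ L) (x∉L ∷ uniq) (Px ∷ PL) =
    subst (suc (length L) ≤_) (≡.sym (count-remove {X = P} Px)) (s≤s (unique-length L uniq (All.zipWith other (PL , x∉L))))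
    where
      other : ∀ {w} → P w ≡ true × x ≢ w → (P ∖ ⁅ x ⁆) w ≡ true
      other {w} (Pw , x≢w) with w ≟ x
      ... | yes refl = ⊥-elim (x≢w refl)
      ... | no _ rewrite Pw = refl

  -- Every edge of a matching M has an endpoint outside an independent set
  -- I, and these endpoints are distinct, so |I| + |M| ≤ n.
  matching-bound : ∀ {I M} → Indep I → Matching G M → count I + length M ≤ n
  matching-bound {I} {M} indI (M-edges , M-unique) = subst (count I + length M ≤_) (count-complement I)
    (+-monoʳ-≤ (count I) (subst (_≤ count (not ∘ I)) (length-map outer M)
      (unique-length {not ∘ I} (map outer M) (outer-unique M M-unique) (outer-∉I M M-edges))))
    where
      outer : Fin n × Fin n → Fin n
      outer (u , v) = if I u then v else u
      outer-endpoint : ∀ e → outer e ≡ proj₁ e ⊎ outer e ≡ proj₂ e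
      outer-endpoint (u , v) with I u
      ... | true = inj₂ refl
      ... | false = inj₁ refl
      outer-∉I : ∀ M → All (λ e → adj G (proj₁ e) (proj₂ e) ≡ true) M → All (λ w → not (I w) ≡ true) (map outer M)
      outer-∉I [] [] = []
      outer-∉I ((u , v) ∷ M) (uv ∷ rest) with I u in Iu
      ... | true = not-false (¬-not λ Iv → true≢false uv (indI u v Iu Iv)) ∷ outer-∉I M rest
      ... | false = not-false Iu ∷ outer-∉I M rest
      outer-∈ : ∀ M {w} → w ∈ₗ map outer M → w ∈ₗ endpoints G M
      outer-∈ (e ∷ M) (here refl) with outer-endpoint e
      ... | inj₁ eq = here eq
      ... | inj₂ eq = there (here eq)
      outer-∈ (e ∷ M) (there w∈) = there (there (outer-∈ M w∈))
      outer-unique : ∀ M → Unique (endpoints G M) → Unique (map outer M)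
      outer-unique [] _ = []
      outer-unique (e ∷ M) ((_ ∷ u∉) ∷ v∉ ∷ uniq) = All.tabulate fresh ∷ outer-unique M uniq
        where
          fresh : ∀ {w} → w ∈ₗ map outer M → outer e ≢ w
          fresh w∈ eq with outer-endpoint e
          ... | inj₁ eq₁ = All.lookup u∉ (outer-∈ M w∈) (trans (≡.sym eq₁) eq)
          ... | inj₂ eq₂ = All.lookup v∉ (outer-∈ M w∈) (trans (≡.sym eq₂) eq)

  -- A maximum independent set A dominates: every vertex lies in A ∪ N(A),
  -- since otherwise A ∪ {v} would be a larger independent set.
  maximum-dominating : ∀ {A} → MaximumIndependent G A → ∀ v → (lookup A ∪ nb (lookup A)) v ≡ true
  maximum-dominating {A} (indA , largest) v with lookup A v in Av | nb (lookup A) v in NAv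
  ... | true | _ = refl
  ... | false | true = refl
  ... | false | false = ⊥-elim (1+n≰n (begin
    suc (count a)              ≡⟨ count-insert {X = a} Av ⟨
    count (a ∪ ⁅ v ⁆)          ≡⟨ ∣tabulate∣-count (a ∪ ⁅ v ⁆) ⟨
    ∣ tabulate (a ∪ ⁅ v ⁆) ∣   ≤⟨ largest _ (indep-tabulate (indep-∪ (indep-lookup indA) v-indep v#NA)) ⟩
    ∣ A ∣                      ≡⟨ ∣∣-count A ⟩
    count a                    ∎))
    where
      open ≤-Reasoning
      a : VSet n
      a = lookup A
      v-indep : Indep ⁅ v ⁆
      v-indep u w e e′ = subst₂ (λ p q → adj G p q ≡ false) (≡.sym (⁅⁆-sound e)) (≡.sym (⁅⁆-sound e′)) (Graph.irrefl G v)
      v#NA : Disjoint ⁅ v ⁆ (nb a)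
      v#NA u e = subst (λ w → nb a w ≡ false) (≡.sym (⁅⁆-sound e)) NAv

  -- Hall's theorem with the Hall property of A
  -- matches N(A) into A; as A ∪ N(A) = V this matching has n − |A| edges,
  -- which matching-bound shows is the most possible.
  critical-maximum⇒KE : ∀ {A} → Critical G A → MaximumIndependent G A → KonigEgervary G
  critical-maximum⇒KE {A} critA maxA = A , edges μ , maxA , (matching μ , maximum) , size
    where
      a : VSet n
      a = lookup A
      indA : Indep a
      indA = indep-lookup (proj₁ critA)
      μ : MatchingInto (nb a) a
      μ = hall _ ≤-refl (#-sym (indep-nb-disjoint indA)) (critical-hall critA)
      size : ∣ A ∣ + length (edges μ) ≡ n
      size = begin
        ∣ A ∣ + length (edges μ)   ≡⟨ cong₂ _+_ (∣∣-count A) (saturating μ) ⟩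
        count a + count (nb a)     ≡⟨ count-∪-disjoint (indep-nb-disjoint indA) ⟨
        count (a ∪ nb a)           ≡⟨ count-cong (maximum-dominating maxA) ⟩
        count {n} (λ _ → true)     ≡⟨ count-all n ⟩
        n                          ∎
        where open ≡-Reasoning
      maximum : ∀ M → Matching G M → length M ≤ length (edges μ)
      maximum M matchingM = +-cancelˡ-≤ (count a) _ _
        (subst (count a + length M ≤_) (trans (≡.sym size) (cong (_+ length (edges μ)) (∣∣-count A)))
          (matching-bound indA matchingM))

  -- If S ⊇ A is independent, A is maximum critical, and every vertex of S
  -- lies in some critical independent set, then S ⊆ A: by covering each
  -- vertex of S lies in A ∪ N(A), and S avoids N(A).
  absorbed : ∀ {A S} → MaxCritical G A → Independent G S → A ⊆ S →
    (∀ {v} → v ∈ S → ∃ λ B → Critical G B × v ∈ B) → S ⊆ A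
  absorbed {A} {S} maxCritA indS A⊆S in-critical {v} v∈S
    with ∨-elim (maxCritical-covers maxCritA (proj₁ (proj₂ B)) v ([]=⇒lookup (proj₂ (proj₂ B))))
    where
      B : ∃ λ B → Critical G B × v ∈ B
      B = in-critical v∈S
  ... | inj₁ Av = lookup⇒[]= v A Av
  ... | inj₂ NAv = let (u , Au , vu) = nb-elim NAv in
    ⊥-elim (true≢false vu (indS v u v∈S (A⊆S (lookup⇒[]= u A Au))))

theorem2p8 : ∀ {n : ℕ} (G : Graph n) (Γ Γ′ : Subset n → Set) →
    (∀ S → Γ S → MaximumIndependent G S) →
    (∀ A → Γ′ A → MaxCritical G A) →
    (∃ λ A → Γ′ A) →
    (∀ A → Γ′ A → ∃ λ S → Γ S × A ⊆ S) →
    (∀ v → (v ∈⋃ Γ′) ⇔ (v ∈⋃ Γ)) →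
    KonigEgervary G
-- A ∈ Γ′ lies in some S ∈ Γ; S is absorbed into A, so the critical set A is
-- also a maximum independent set, and Larson's criterion applies.
theorem2p8 G Γ Γ′ Γ-maximum Γ′-maxCritical (A , A∈Γ′) Γ′-below-Γ same-union =
  critical-maximum⇒KE G critA (proj₁ critA , λ I indI → ≤-trans (proj₂ S-maximum I indI) (p⊆q⇒∣p∣≤∣q∣ S⊆A))
  where
    critA : Critical G A
    critA = proj₁ (Γ′-maxCritical A A∈Γ′)
    S-above-A : ∃ λ S → Γ S × A ⊆ S
    S-above-A = Γ′-below-Γ A A∈Γ′
    S : Subset _
    S = proj₁ S-above-A
    S-maximum : MaximumIndependent G S
    S-maximum = Γ-maximum S (proj₁ (proj₂ S-above-A))
    in-critical : ∀ {v} → v ∈ S → ∃ λ B → Critical G B × v ∈ B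
    in-critical {v} v∈S with Equivalence.from (same-union v) (S , proj₁ (proj₂ S-above-A) , v∈S)
    ... | B , B∈Γ′ , v∈B = B , proj₁ (Γ′-maxCritical B B∈Γ′) , v∈B
    S⊆A : S ⊆ A
    S⊆A = absorbed G (Γ′-maxCritical A A∈Γ′) (proj₁ S-maximum) (proj₂ (proj₂ S-above-A)) in-critical
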